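{- Let $G$ be a graph with a unique maximum open packing $U(G)$, and let $x\notin U(G)$ be a vertex having a neighbor $y\in U(G)$. If $G'$ is obtained from $G$ by appending a path $P_3$ to $x$ (adding a new path on 3 vertices and joining $x$ to one of its end vertices), then $G'$ has a unique maximum open packing.
   Context: An open packing in a graph is a set of vertices whose open neighborhoods are pairwise disjoint; a maximum open packing is one of maximum cardinality. -}

module Defs where

open import Data.Nat using (ℕ; suc; _≤_; _+_)
open import Data.Fin using (Fin; zero; suc)
open import Data.Fin.Properties using (_≟_)
open import Data.Fin.Subset using (Subset; _∈_; _∉_; ∣_∣)
open import Data.Product using (Σ; _×_; _,_; ∃)
open import Data.Unit using (⊤; tt)
open import Data.Empty using (⊥)
open import Relation.Nullary using (¬_; Dec; yes; no)
open import Relation.Binary.PropositionalEquality using (_≡_; _≢_; refl)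

record Graph (n : ℕ) : Set₁ where
  field
    Adj    : Fin n → Fin n → Set
    sym    : ∀ {u v} → Adj u v → Adj v u
    irrefl : ∀ {u} → ¬ Adj u u
    dec    : ∀ u v → Dec (Adj u v)
open Graph public

_∈N[_]_ : ∀ {n} → Fin n → Graph n → Fin n → Set
w ∈N[ G ] u = Adj G u w

IsOpenPacking : ∀ {n} → Graph n → Subset n → Set
IsOpenPacking G S = ∀ u v → u ∈ S → v ∈ S → u ≢ v →
  ∀ w → ¬ (w ∈N[ G ] u × w ∈N[ G ] v)

IsMaxOpenPacking : ∀ {n} → Graph n → Subset n → Set
IsMaxOpenPacking G S = IsOpenPacking G S ×
  (∀ T → IsOpenPacking G T → ∣ T ∣ ≤ ∣ S ∣)

IsUniqueMaxOpenPacking : ∀ {n} → Graph n → Subset n → Set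
IsUniqueMaxOpenPacking G S = IsMaxOpenPacking G S × (∀ T → IsMaxOpenPacking G T → T ≡ S)

HasUniqueMaxOpenPacking : ∀ {n} → Graph n → Set
HasUniqueMaxOpenPacking G = ∃ λ S → IsUniqueMaxOpenPacking G S

-- Appending a path P3 = p0 p1 p2 to x: vertex set Fin (3 + n), where
-- zero = p0, suc zero = p1, suc (suc zero) = p2 (new vertices) and
-- suc (suc (suc i)) is the old vertex i.
module _ {n : ℕ} (G : Graph n) (x : Fin n) where
  private
    A : Fin (3 + n) → Fin (3 + n) → Set
    A (suc (suc (suc i))) (suc (suc (suc j))) = Adj G i j
    A zero (suc (suc (suc j))) = j ≡ x
    A (suc (suc (suc i))) zero = i ≡ x
    A zero (suc zero) = ⊤
    A (suc zero) zero = ⊤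
    A (suc zero) (suc (suc zero)) = ⊤
    A (suc (suc zero)) (suc zero) = ⊤
    A _ _ = ⊥

    A-sym : ∀ {u v} → A u v → A v u
    A-sym {suc (suc (suc i))} {suc (suc (suc j))} e = Graph.sym G e
    A-sym {zero} {suc (suc (suc j))} e = e
    A-sym {suc (suc (suc i))} {zero} e = e
    A-sym {zero} {suc zero} e = tt
    A-sym {suc zero} {zero} e = tt
    A-sym {suc zero} {suc (suc zero)} e = tt
    A-sym {suc (suc zero)} {suc zero} e = tt
    A-sym {zero} {zero} ()
    A-sym {zero} {suc (suc zero)} ()
    A-sym {suc zero} {suc zero} ()
    A-sym {suc zero} {suc (suc (suc _))} ()
    A-sym {suc (suc zero)} {zero} ()
    A-sym {suc (suc zero)} {suc (suc zero)} ()
    A-sym {suc (suc zero)} {suc (suc (suc _))} ()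
    A-sym {suc (suc (suc _))} {suc zero} ()
    A-sym {suc (suc (suc _))} {suc (suc zero)} ()

    A-irr : ∀ {u} → ¬ A u u
    A-irr {zero} ()
    A-irr {suc zero} ()
    A-irr {suc (suc zero)} ()
    A-irr {suc (suc (suc i))} e = Graph.irrefl G e

    A-dec : ∀ u v → Dec (A u v)
    A-dec (suc (suc (suc i))) (suc (suc (suc j))) = Graph.dec G i j
    A-dec zero (suc (suc (suc j))) = j ≟ x
    A-dec (suc (suc (suc i))) zero = i ≟ x
    A-dec zero (suc zero) = yes tt
    A-dec (suc zero) zero = yes tt
    A-dec (suc zero) (suc (suc zero)) = yes tt
    A-dec (suc (suc zero)) (suc zero) = yes tt
    A-dec zero zero = no λ ()
    A-dec zero (suc (suc zero)) = no λ ()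
    A-dec (suc zero) (suc zero) = no λ ()
    A-dec (suc zero) (suc (suc (suc _))) = no λ ()
    A-dec (suc (suc zero)) zero = no λ ()
    A-dec (suc (suc zero)) (suc (suc zero)) = no λ ()
    A-dec (suc (suc zero)) (suc (suc (suc _))) = no λ ()
    A-dec (suc (suc (suc _))) (suc zero) = no λ ()
    A-dec (suc (suc (suc _))) (suc (suc zero)) = no λ ()

  appendP3 : Graph (3 + n)
  appendP3 = record { Adj = A ; sym = λ {u} {v} → A-sym {u} {v} ; irrefl = λ {u} → A-irr {u} ; dec = A-dec }

module Submission where

-- We show that U' = {p1, p2} ∪ U is the unique maximum open packing of G'.
--
-- Throughout we use that S is an open packing iff every vertex has at most
-- one neighbour in S.  With this reformulation:
--   * U' is an open packing, since each vertex of G' has at most one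
--     neighbour in U' (x ∉ U keeps p0 out of the neighbourhoods of U);
--   * a packing T of G' meets the old vertices in a packing S of G and
--     contains at most two of p0, p1, p2 (p0 and p2 share the neighbour p1),
--     so ∣ T ∣ ≤ 2 + ∣ U ∣;
--   * if equality holds then S is maximum in G, hence S = U, and the new part
--     is {p1, p2} or {p0, p1}; the latter is impossible because p0 and y
--     share the neighbour x.

open import Defs
open import Data.Nat using (ℕ; _≤_; _+_; s≤s; z≤n)
open import Data.Nat.Properties
  using (≤-refl; ≤-trans; ≤-antisym; +-mono-≤; +-monoˡ-≤; +-monoʳ-≤; +-cancelˡ-≤; +-cancelʳ-≤)
open import Data.Fin using (Fin; zero; suc)
open import Data.Fin.Properties using (_≟_)
open import Data.Fin.Subset using (Subset; _∈_; _∉_; ∣_∣; inside; outside)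
open import Data.Fin.Subset.Properties using (∣p∣≤n)
open import Data.Vec using (_∷_; []; here; there)
open import Data.Product using (Σ; _×_; _,_)
open import Data.Sum using (_⊎_; inj₁; inj₂)
open import Data.Empty using (⊥-elim)
open import Relation.Nullary using (¬_; yes; no)
open import Relation.Binary.PropositionalEquality using (_≡_; refl; cong; subst)

AtMostOneNeighbourIn : ∀ {n} → Graph n → Subset n → Set
AtMostOneNeighbourIn G S =
  ∀ w u v → u ∈ S → v ∈ S → w ∈N[ G ] u → w ∈N[ G ] v → u ≡ v

packing⇒atMostOne : ∀ {n} (G : Graph n) (S : Subset n) →
  IsOpenPacking G S → AtMostOneNeighbourIn G S
packing⇒atMostOne G S P w u v u∈ v∈ uw vw with u ≟ v
... | yes u≡v = u≡v
... | no  u≢v = ⊥-elim (P u v u∈ v∈ u≢v w (uw , vw))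

atMostOne⇒packing : ∀ {n} (G : Graph n) (S : Subset n) →
  AtMostOneNeighbourIn G S → IsOpenPacking G S
atMostOne⇒packing G S A u v u∈ v∈ u≢v w (uw , vw) = u≢v (A w u v u∈ v∈ uw vw)

tight-sum : ∀ {a k s u : ℕ} → a ≤ k → s ≤ u → k + u ≤ a + s → a ≡ k × u ≤ s
tight-sum {a} {k} {s} {u} a≤k s≤u k+u≤a+s =
  ≤-antisym a≤k (+-cancelʳ-≤ u k a (≤-trans k+u≤a+s (+-monoʳ-≤ a s≤u))) ,
  +-cancelˡ-≤ k u s (≤-trans k+u≤a+s (+-monoˡ-≤ s a≤k))

pattern p0 = zero
pattern p1 = suc zero
pattern p2 = suc (suc zero)
pattern old i = suc (suc (suc i))

size-split : ∀ {n} b0 b1 b2 (S : Subset n) →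
  ∣ b0 ∷ b1 ∷ b2 ∷ S ∣ ≡ ∣ b0 ∷ b1 ∷ b2 ∷ [] ∣ + ∣ S ∣
size-split inside  inside  inside  S = refl
size-split inside  inside  outside S = refl
size-split inside  outside inside  S = refl
size-split inside  outside outside S = refl
size-split outside inside  inside  S = refl
size-split outside inside  outside S = refl
size-split outside outside inside  S = refl
size-split outside outside outside S = refl

path-part-≤2 : ∀ b0 b1 b2 → ¬ (b0 ≡ inside × b2 ≡ inside) →
  ∣ b0 ∷ b1 ∷ b2 ∷ [] ∣ ≤ 2
path-part-≤2 inside  b1      inside  not-ends = ⊥-elim (not-ends (refl , refl))
path-part-≤2 inside  inside  outside _        = ≤-refl
path-part-≤2 inside  outside outside _        = s≤s z≤n
path-part-≤2 outside b1      b2      _        = ∣p∣≤n (b1 ∷ b2 ∷ [])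

path-part-=2 : ∀ b0 b1 b2 → ¬ (b0 ≡ inside × b2 ≡ inside) →
  ∣ b0 ∷ b1 ∷ b2 ∷ [] ∣ ≡ 2 →
  (b0 ≡ outside × b1 ≡ inside × b2 ≡ inside) ⊎
  (b0 ≡ inside × b1 ≡ inside × b2 ≡ outside)
path-part-=2 inside  _       inside  not-ends _ = ⊥-elim (not-ends (refl , refl))
path-part-=2 inside  inside  outside _ _ = inj₂ (refl , refl , refl)
path-part-=2 outside inside  inside  _ _ = inj₁ (refl , refl , refl)
path-part-=2 inside  outside outside _ ()
path-part-=2 outside inside  outside _ ()
path-part-=2 outside outside inside  _ ()
path-part-=2 outside outside outside _ ()

module AppendedPath {n : ℕ} (G : Graph n) (x : Fin n) where

  G' : Graph (3 + n)
  G' = appendP3 G x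

  extend : Subset n → Subset (3 + n)
  extend U = outside ∷ inside ∷ inside ∷ U

  old-injective : ∀ {i j : Fin n} → old i ≡ old j → i ≡ j
  old-injective refl = refl

  restrict : ∀ b0 b1 b2 S → IsOpenPacking G' (b0 ∷ b1 ∷ b2 ∷ S) → IsOpenPacking G S
  restrict b0 b1 b2 S P = atMostOne⇒packing G S λ w u v u∈ v∈ uw vw →
    old-injective (packing⇒atMostOne G' _ P (old w) (old u) (old v)
      (there (there (there u∈))) (there (there (there v∈))) uw vw)

  -- The end points p0 and p2 of the path share the neighbour p1.
  not-both-ends : ∀ b0 b1 b2 S → IsOpenPacking G' (b0 ∷ b1 ∷ b2 ∷ S) →
    ¬ (b0 ≡ inside × b2 ≡ inside)
  not-both-ends .inside b1 .inside S P (refl , refl) =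
    P p0 p2 here (there (there here)) (λ ()) p1 (_ , _)

  packing-size : ∀ b0 b1 b2 S → IsOpenPacking G' (b0 ∷ b1 ∷ b2 ∷ S) →
    ∣ b0 ∷ b1 ∷ b2 ∷ [] ∣ ≤ 2 × IsOpenPacking G S
  packing-size b0 b1 b2 S P =
    path-part-≤2 b0 b1 b2 (not-both-ends b0 b1 b2 S P) , restrict b0 b1 b2 S P

  module _ (U : Subset n) (x∉U : x ∉ U) where

    -- The neighbours in extend U of each kind of vertex; the only neighbour
    -- of p0 outside the path is x, which is not in U.
    p0-neighbour : ∀ u → u ∈ extend U → p0 ∈N[ G' ] u → u ≡ p1
    p0-neighbour p0      ()
    p0-neighbour p1      _ _ = refl
    p0-neighbour p2      _ ()
    p0-neighbour (old j) (there (there (there j∈))) j≡x = ⊥-elim (x∉U (subst (_∈ U) j≡x j∈))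

    p1-neighbour : ∀ u → u ∈ extend U → p1 ∈N[ G' ] u → u ≡ p2
    p1-neighbour p0      ()
    p1-neighbour p1      _ ()
    p1-neighbour p2      _ _ = refl
    p1-neighbour (old _) _ ()

    p2-neighbour : ∀ u → u ∈ extend U → p2 ∈N[ G' ] u → u ≡ p1
    p2-neighbour p0      ()
    p2-neighbour p1      _ _ = refl
    p2-neighbour p2      _ ()
    p2-neighbour (old _) _ ()

    old-neighbour : ∀ k u → u ∈ extend U → old k ∈N[ G' ] u →
      Σ (Fin n) λ j → u ≡ old j × j ∈ U × k ∈N[ G ] j
    old-neighbour k p0      ()
    old-neighbour k p1      _ ()
    old-neighbour k p2      _ ()
    old-neighbour k (old j) (there (there (there j∈))) jk = j , refl , j∈ , jk

    extend-packing : IsOpenPacking G U → IsOpenPacking G' (extend U)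
    extend-packing P = atMostOne⇒packing G' (extend U) unique
      where
      unique : AtMostOneNeighbourIn G' (extend U)
      unique p0 u v u∈ v∈ uw vw with refl ← p0-neighbour u u∈ uw
                                   | refl ← p0-neighbour v v∈ vw = refl
      unique p1 u v u∈ v∈ uw vw with refl ← p1-neighbour u u∈ uw
                                   | refl ← p1-neighbour v v∈ vw = refl
      unique p2 u v u∈ v∈ uw vw with refl ← p2-neighbour u u∈ uw
                                   | refl ← p2-neighbour v v∈ vw = refl
      unique (old k) u v u∈ v∈ uw vw
        with i , refl , i∈ , ik ← old-neighbour k u u∈ uw
           | j , refl , j∈ , jk ← old-neighbour k v v∈ vw =
        cong (λ z → old z) (packing⇒atMostOne G U P k i j i∈ j∈ ik jk)

  extend-bound : ∀ U → (∀ S → IsOpenPacking G S → ∣ S ∣ ≤ ∣ U ∣) →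
    ∀ T → IsOpenPacking G' T → ∣ T ∣ ≤ ∣ extend U ∣
  extend-bound U max (b0 ∷ b1 ∷ b2 ∷ S) P
    rewrite size-split b0 b1 b2 S
    with path≤2 , PS ← packing-size b0 b1 b2 S P = +-mono-≤ path≤2 (max S PS)

  extend-unique : ∀ U → IsUniqueMaxOpenPacking G U → ∀ y → y ∈ U → Adj G x y →
    ∀ T → IsOpenPacking G' T → ∣ extend U ∣ ≤ ∣ T ∣ → T ≡ extend U
  extend-unique U ((_ , max) , unique) y y∈U xy (b0 ∷ b1 ∷ b2 ∷ S) P large
    rewrite size-split b0 b1 b2 S
    with path≤2 , PS ← packing-size b0 b1 b2 S P
    with path≡2 , U≤S ← tight-sum path≤2 (max S PS) large
    with refl ← unique S (PS , λ R PR → ≤-trans (max R PR) U≤S)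
    with path-part-=2 b0 b1 b2 (not-both-ends b0 b1 b2 S P) path≡2
  ... | inj₁ (refl , refl , refl) = refl
  ... | inj₂ (refl , refl , refl) =
    -- p0 and y would share the neighbour x
    ⊥-elim (P p0 (old y) here (there (there (there y∈U))) (λ ())
              (old x) (refl , Graph.sym G xy))

mainTheorem15 : {n : ℕ} (G : Graph n) (U : Subset n) →
    IsUniqueMaxOpenPacking G U →
    (x y : Fin n) → x ∉ U → y ∈ U → Adj G x y →
    HasUniqueMaxOpenPacking (appendP3 G x)
mainTheorem15 G U U-unique@((U-packing , U-max) , _) x y x∉U y∈U xy =
  extend U , (extend-packing U x∉U U-packing , extend-bound U U-max) ,
  λ T (T-packing , T-max) →
    extend-unique U U-unique y y∈U xy T T-packing
      (T-max (extend U) (extend-packing U x∉U U-packing))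
  where open AppendedPath G x
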